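{- Let $A$ be a finite alphabet, $X$ a finite set and $(o,\delta):X\to\mathbb{B}\times\mathcal{T}(X)^A$ a syntactic system of behavioural differential equations. Let $Y$, $(Y,(o',\delta'))$, its extension $(\mathcal{P}_\omega(Y^*),(\hat o,\hat\delta))$ and $f:\mathcal{T}(X)\to\mathcal{P}_\omega(Y^*)$ be as defined below. Then $f$ is a $\mathbb{B}\times(-)^A$-coalgebra homomorphism from $(\mathcal{T}(X),(\bar o,\bar\delta))$ to $(\mathcal{P}_\omega(Y^*),(\hat o,\hat\delta))$, i.e. for all $\sigma\in\mathcal{T}(X)$ and $a\in A$: $\hat o(f(\sigma))=\bar o(\sigma)$ and $f(\sigma)_a=f(\sigma_a)$.
   Context: $\mathcal{T}(X)$ is the set of syntactic terms $\tau::=\bar 0\mid\bar 1\mid\bar x\ (x\in X)\mid\bar a\ (a\in A)\mid\tau+\tau\mid\tau\times\tau$; write $x_a=\delta(x)(a)$. With $j(0)=\bar 0$, $j(1)=\bar 1$, the extension $(\bar o,\bar\delta)$ on $\mathcal{T}(X)$ (write $\tau_a=\bar\delta(\tau)(a)$) is: $\bar o(\bar x)=o(x)$, $\bar x_a=x_a$; $\bar o(\bar 0)=0$, $\bar 0_a=\bar 0$; $\bar o(\bar 1)=1$, $\bar 1_a=\bar 0$; $\bar o(\bar b)=0$, $\bar b_a=\bar 1$ if $b=a$ else $\bar 0$; $\bar o(\sigma+\upsilon)=\bar o(\sigma)\vee\bar o(\upsilon)$, $(\sigma+\upsilon)_a=\sigma_a+\upsilon_a$; $\bar o(\sigma\times\upsilon)=\bar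 o(\sigma)\wedge\bar o(\upsilon)$, $(\sigma\times\upsilon)_a=(\sigma_a\times\upsilon)+(j(\bar o(\sigma))\times\upsilon_a)$. $Y=\{\hat x\mid x\in X\}\cup\{\hat a\mid a\in A\}$ (fresh symbols). $f$ is defined by $f(\bar x)=\{\hat x\}$, $f(\bar 0)=\emptyset$, $f(\bar 1)=\{\epsilon\}$, $f(\bar a)=\{\hat a\}$, $f(\sigma+\upsilon)=f(\sigma)\cup f(\upsilon)$, $f(\sigma\times\upsilon)=f(\sigma)f(\upsilon)$ (language concatenation). With $i(1)=\{\epsilon\}$, $i(0)=\emptyset$, the map $(o',\delta'):Y\to\mathbb{B}\times\mathcal{P}_\omega(Y^*)^A$ is $o'(\hat x)=o(x)$, $\delta'(\hat x)(a)=f(x_a)$, $o'(\hat b)=0$, $\delta'(\hat b)(a)=i(1)$ if $b=a$ and $i(0)$ otherwise. Its extension $(\hat o,\hat\delta)$ on $\mathcal{P}_\omega(Y^*)$ (write $S_a=\hat\delta(S)(a)$, $y_a=\delta'(y)(a)$) is: $\hat o(\{\epsilon\})=1$, $\{\epsilon\}_a=\emptyset$; for $y\in Y$, $w\in Y^*$: $\hat o(\{yw\})=o'(y)\wedge\hat o(\{w\})$, $\{yw\}_a=y_a\{w\}\cup i(o'(y))\{w\}_a$; for finite $S$: $\hat o(S)=\bigvee_{s\in S}\hat o(\{s\})$, $S_a=\bigcup_{s\in S}\{s\}_a$. -}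

module Defs where

open import Data.Nat using (ℕ)
open import Data.Fin using (Fin; _≟_)
open import Data.Bool using (Bool; true; false; _∧_; _∨_; if_then_else_)
open import Data.Sum using (_⊎_; inj₁; inj₂)
open import Data.Product using (_×_)
open import Data.List using (List; []; _∷_; [_]; _++_; map; concatMap)
open import Data.List.Membership.Propositional using (_∈_)
open import Relation.Nullary using (does)

data Term (nX nA : ℕ) : Set where
  𝟘 𝟙 : Term nX nA
  var : Fin nX → Term nX nA
  sym : Fin nA → Term nX nA
  _⊕_ : Term nX nA → Term nX nA → Term nX nA
  _⊗_ : Term nX nA → Term nX nA → Term nX nA

Y : ℕ → ℕ → Set
Y nX nA = Fin nX ⊎ Fin nA

-- Finite languages P_ω(Y*) represented by lists of words, compared as sets.
Lang : Set → Set
Lang B = List (List B)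

_·_ : {B : Set} → Lang B → Lang B → Lang B
S · T = concatMap (λ u → map (u ++_) T) S

_≋_ : {B : Set} → Lang B → Lang B → Set
S ≋ T = ∀ w → (w ∈ S → w ∈ T) × (w ∈ T → w ∈ S)

i : {B : Set} → Bool → Lang B
i true = [ [] ]
i false = []

module System {nX nA : ℕ}
  (o : Fin nX → Bool) (δ : Fin nX → Fin nA → Term nX nA) where

  j : Bool → Term nX nA
  j true = 𝟙
  j false = 𝟘

  ō : Term nX nA → Bool
  ō 𝟘 = false
  ō 𝟙 = true
  ō (var x) = o x
  ō (sym b) = false
  ō (σ ⊕ υ) = ō σ ∨ ō υ
  ō (σ ⊗ υ) = ō σ ∧ ō υ

  δ̄ : Term nX nA → Fin nA → Term nX nA
  δ̄ 𝟘 a = 𝟘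
  δ̄ 𝟙 a = 𝟘
  δ̄ (var x) a = δ x a
  δ̄ (sym b) a = if does (b ≟ a) then 𝟙 else 𝟘
  δ̄ (σ ⊕ υ) a = δ̄ σ a ⊕ δ̄ υ a
  δ̄ (σ ⊗ υ) a = (δ̄ σ a ⊗ υ) ⊕ (j (ō σ) ⊗ δ̄ υ a)

  f : Term nX nA → Lang (Y nX nA)
  f 𝟘 = []
  f 𝟙 = [ [] ]
  f (var x) = [ [ inj₁ x ] ]
  f (sym a) = [ [ inj₂ a ] ]
  f (σ ⊕ υ) = f σ ++ f υ
  f (σ ⊗ υ) = f σ · f υ

  o′ : Y nX nA → Bool
  o′ (inj₁ x) = o x
  o′ (inj₂ b) = false

  δ′ : Y nX nA → Fin nA → Lang (Y nX nA)
  δ′ (inj₁ x) a = f (δ x a)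
  δ′ (inj₂ b) a = if does (b ≟ a) then i true else i false

  ôw : List (Y nX nA) → Bool
  ôw [] = true
  ôw (y ∷ w) = o′ y ∧ ôw w

  δ̂w : List (Y nX nA) → Fin nA → Lang (Y nX nA)
  δ̂w [] a = []
  δ̂w (y ∷ w) a = (δ′ y a · [ w ]) ++ (i (o′ y) · δ̂w w a)

  ô : Lang (Y nX nA) → Bool
  ô [] = false
  ô (s ∷ S) = ôw s ∨ ô S

  δ̂ : Lang (Y nX nA) → Fin nA → Lang (Y nX nA)
  δ̂ S a = concatMap (λ s → δ̂w s a) S

-- Finite languages under union and concatenation form an idempotent semiring,
-- and (ô, δ̂) respects it: ô is a semiring map into 𝔹, δ̂ is additive, and δ̂
-- obeys the product rule  δ̂ (S · T) = δ̂ S · T ∪ i (ô S) · δ̂ T.  Since f sends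
-- + and × to ∪ and ·, and δ̄ differentiates a product of terms by the same
-- rule, both equations follow by induction on σ.  The product rule is proved
-- first for single words, by induction on the left factor, and then lifted to
-- languages by distributivity; only left distributivity of · over ∪ needs set
-- equality, all other laws used hold on the nose for the list representation.

module Submission where

open import Defs
open import Data.Nat using (ℕ)
open import Data.Fin using (Fin; _≟_)
open import Data.Bool using (Bool; true; false; _∧_; _∨_)
open import Data.Bool.Properties using (∧-assoc; ∨-assoc; ∧-zeroʳ; ∧-distribˡ-∨; ∧-distribʳ-∨; ∨-identityʳ; ∧-identityʳ)
open import Data.Product using (_×_; _,_)
open import Data.Sum using (inj₁)
open import Data.List using (List; []; _∷_; [_]; _++_; map; concatMap)
open import Data.List.Properties using (++-assoc; ++-identityʳ; map-id; map-∘; map-++; map-cong; concatMap-cong; concatMap-map; map-concatMap; concatMap-++; concat-map-[_])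
open import Data.List.Effectful using (module MonadProperties)
open import Data.List.Relation.Binary.BagAndSetEquality using (_∼[_]_; set; [_]-Equality; commutativeMonoid; ++-cong; >>=-cong; ++-idempotent) renaming (map-cong to map-cong-∼)
open import Algebra.Bundles using (CommutativeMonoid)
import Algebra.Properties.CommutativeSemigroup as CommutativeSemigroupProperties
open import Function.Bundles using (Equivalence)
open import Relation.Nullary using (does)
open import Relation.Binary.Bundles using (Setoid)
import Relation.Binary.Reasoning.Setoid as SetoidReasoning
open import Relation.Binary.PropositionalEquality as ≡ using (_≡_; refl; trans; cong; cong₂; module ≡-Reasoning)

module Languages {B : Set} where

  private
    module Eq = Setoid ([ set ]-Equality (List B))
    open CommutativeSemigroupProperties
      (CommutativeMonoid.commutativeSemigroup (commutativeMonoid set (List B)))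
      using (interchange)
    module ∼-Reasoning = SetoidReasoning ([ set ]-Equality (List B))

  ∼⇒≋ : {S T : Lang B} → S ∼[ set ] T → S ≋ T
  ∼⇒≋ S∼T w = Equivalence.to S∼T , Equivalence.from S∼T

  concatMap-∼-cong : {f g : List B → Lang B} → (∀ s → f s ∼[ set ] g s) →
                     (S : Lang B) → concatMap f S ∼[ set ] concatMap g S
  concatMap-∼-cong f∼g S = >>=-cong (Eq.refl {S}) f∼g

  concatMap-++-pointwise : (f g : List B → Lang B) (S : Lang B) →
    concatMap (λ s → f s ++ g s) S ∼[ set ] concatMap f S ++ concatMap g S
  concatMap-++-pointwise f g [] = Eq.refl
  concatMap-++-pointwise f g (s ∷ S) = begin
    (f s ++ g s) ++ concatMap (λ s → f s ++ g s) S
      ≈⟨ ++-cong Eq.refl (concatMap-++-pointwise f g S) ⟩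
    (f s ++ g s) ++ (concatMap f S ++ concatMap g S)
      ≈⟨ interchange (f s) (g s) _ _ ⟩
    (f s ++ concatMap f S) ++ (g s ++ concatMap g S) ∎
    where open ∼-Reasoning

  i-∨ : (b c : Bool) → i {B} (b ∨ c) ∼[ set ] i b ++ i c
  i-∨ true true = Eq.sym (++-idempotent [ [] ])
  i-∨ true false = Eq.refl
  i-∨ false c = Eq.refl

  ·-cong : {S S′ T T′ : Lang B} → S ∼[ set ] S′ → T ∼[ set ] T′ → S · T ∼[ set ] S′ · T′
  ·-cong S∼S′ T∼T′ = >>=-cong S∼S′ (λ u → map-cong-∼ (λ _ → refl) T∼T′)

  ·-identityˡ : (S : Lang B) → [ [] ] · S ≡ S
  ·-identityˡ S = trans (++-identityʳ (map (λ v → v) S)) (map-id S)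

  ·-identityʳ : (S : Lang B) → S · [ [] ] ≡ S
  ·-identityʳ S = trans (concatMap-cong (λ u → cong [_] (++-identityʳ u)) S) (concat-map-[ S ])

  ·-zeroʳ : (S : Lang B) → S · [] ≡ []
  ·-zeroʳ = MonadProperties.right-zero

  ·-concatMapʳ : (g : List B → Lang B) (S T : Lang B) →
                 concatMap g S · T ≡ concatMap (λ s → g s · T) S
  ·-concatMapʳ g S T = ≡.sym (MonadProperties.associative S g (λ u → map (u ++_) T))

  map-prefix-· : (u : List B) (T U : Lang B) → map (u ++_) T · U ≡ map (u ++_) (T · U)
  map-prefix-· u T U = begin
    concatMap (λ t → map (t ++_) U) (map (u ++_) T)
      ≡⟨ concatMap-map (λ t → map (t ++_) U) (u ++_) T ⟩
    concatMap (λ t → map ((u ++ t) ++_) U) T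
      ≡⟨ concatMap-cong (λ t → trans (map-cong (++-assoc u t) U) (map-∘ U)) T ⟩
    concatMap (λ t → map (u ++_) (map (t ++_) U)) T
      ≡⟨ ≡.sym (map-concatMap (u ++_) (λ t → map (t ++_) U) T) ⟩
    map (u ++_) (T · U) ∎
    where open ≡-Reasoning

  ·-assoc : (S T U : Lang B) → (S · T) · U ≡ S · (T · U)
  ·-assoc S T U = trans (·-concatMapʳ (λ s → map (s ++_) T) S U)
                        (concatMap-cong (λ s → map-prefix-· s T U) S)

  ·-++-distribˡ : (S T U : Lang B) → S · (T ++ U) ∼[ set ] S · T ++ S · U
  ·-++-distribˡ S T U = begin
    S · (T ++ U)
      ≡⟨ concatMap-cong (λ s → map-++ (s ++_) T U) S ⟩
    concatMap (λ s → map (s ++_) T ++ map (s ++_) U) S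
      ≈⟨ concatMap-++-pointwise (λ s → map (s ++_) T) (λ s → map (s ++_) U) S ⟩
    S · T ++ S · U ∎
    where open ∼-Reasoning

  ·-concatMapˡ : (g : List B → Lang B) (S T : Lang B) →
                 S · concatMap g T ∼[ set ] concatMap (λ t → S · g t) T
  ·-concatMapˡ g S [] = Eq.reflexive (·-zeroʳ S)
  ·-concatMapˡ g S (t ∷ T) = Eq.trans (·-++-distribˡ S (g t) (concatMap g T))
                                      (++-cong Eq.refl (·-concatMapˡ g S T))

open Languages

module Homomorphism {nX nA : ℕ} (o : Fin nX → Bool) (δ : Fin nX → Fin nA → Term nX nA) where

  open System o δ

  private
    Word : Set
    Word = List (Y nX nA)

    Language : Set
    Language = Lang (Y nX nA)

    module Eq = Setoid ([ set ]-Equality Word)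
    module ∼-Reasoning = SetoidReasoning ([ set ]-Equality Word)

  ôw-++ : (u v : Word) → ôw (u ++ v) ≡ ôw u ∧ ôw v
  ôw-++ [] v = refl
  ôw-++ (y ∷ u) v = trans (cong (o′ y ∧_) (ôw-++ u v)) (≡.sym (∧-assoc (o′ y) (ôw u) (ôw v)))

  ô-++ : (S T : Language) → ô (S ++ T) ≡ ô S ∨ ô T
  ô-++ [] T = refl
  ô-++ (s ∷ S) T = trans (cong (ôw s ∨_) (ô-++ S T)) (≡.sym (∨-assoc (ôw s) (ô S) (ô T)))

  ô-map-prefix : (u : Word) (T : Language) → ô (map (u ++_) T) ≡ ôw u ∧ ô T
  ô-map-prefix u [] = ≡.sym (∧-zeroʳ (ôw u))
  ô-map-prefix u (v ∷ T) = trans (cong₂ _∨_ (ôw-++ u v) (ô-map-prefix u T))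
                                 (≡.sym (∧-distribˡ-∨ (ôw u) (ôw v) (ô T)))

  ô-· : (S T : Language) → ô (S · T) ≡ ô S ∧ ô T
  ô-· [] T = refl
  ô-· (s ∷ S) T = begin
    ô (map (s ++_) T ++ S · T)     ≡⟨ ô-++ (map (s ++_) T) (S · T) ⟩
    ô (map (s ++_) T) ∨ ô (S · T)  ≡⟨ cong₂ _∨_ (ô-map-prefix s T) (ô-· S T) ⟩
    ôw s ∧ ô T ∨ ô S ∧ ô T         ≡⟨ ∧-distribʳ-∨ (ô T) (ôw s) (ô S) ⟨
    (ôw s ∨ ô S) ∧ ô T             ∎
    where open ≡-Reasoning

  δ̂w-++ : (u v : Word) (a : Fin nA) →
          δ̂w (u ++ v) a ∼[ set ] δ̂w u a · [ v ] ++ i (ôw u) · δ̂w v a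
  δ̂w-++ [] v a = Eq.reflexive (≡.sym (·-identityˡ (δ̂w v a)))
  -- Splitting on o′ y turns i (o′ y) · X into [] or, up to ·-identityˡ, X.
  δ̂w-++ (y ∷ u) v a with o′ y
  ... | false = Eq.reflexive (begin
    δ′ y a · [ u ++ v ] ++ []             ≡⟨ cong (_++ []) (·-assoc (δ′ y a) [ u ] [ v ]) ⟨
    (δ′ y a · [ u ]) · [ v ] ++ []        ≡⟨ cong (λ S → S · [ v ] ++ []) (++-identityʳ (δ′ y a · [ u ])) ⟨
    (δ′ y a · [ u ] ++ []) · [ v ] ++ []  ∎)
    where open ≡-Reasoning
  ... | true = begin
    δ′ y a · [ u ++ v ] ++ [ [] ] · δ̂w (u ++ v) a
      ≡⟨ cong (δ′ y a · [ u ++ v ] ++_) (·-identityˡ (δ̂w (u ++ v) a)) ⟩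
    δ′ y a · [ u ++ v ] ++ δ̂w (u ++ v) a
      ≈⟨ ++-cong Eq.refl (δ̂w-++ u v a) ⟩
    δ′ y a · [ u ++ v ] ++ (δ̂w u a · [ v ] ++ R)
      ≡⟨ ++-assoc (δ′ y a · [ u ++ v ]) (δ̂w u a · [ v ]) R ⟨
    (δ′ y a · [ u ++ v ] ++ δ̂w u a · [ v ]) ++ R
      ≡⟨ cong (λ S → (S ++ δ̂w u a · [ v ]) ++ R) (·-assoc (δ′ y a) [ u ] [ v ]) ⟨
    ((δ′ y a · [ u ]) · [ v ] ++ δ̂w u a · [ v ]) ++ R
      ≡⟨ cong (_++ R) (concatMap-++ (λ w → map (w ++_) [ v ]) (δ′ y a · [ u ]) (δ̂w u a)) ⟨
    (δ′ y a · [ u ] ++ δ̂w u a) · [ v ] ++ R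
      ≡⟨ cong (λ S → (δ′ y a · [ u ] ++ S) · [ v ] ++ R) (·-identityˡ (δ̂w u a)) ⟨
    (δ′ y a · [ u ] ++ [ [] ] · δ̂w u a) · [ v ] ++ R ∎
    where
    open ∼-Reasoning
    R = i (ôw u) · δ̂w v a

  δ̂-map-prefix : (u : Word) (T : Language) (a : Fin nA) →
                 δ̂ (map (u ++_) T) a ∼[ set ] δ̂w u a · T ++ i (ôw u) · δ̂ T a
  δ̂-map-prefix u T a = begin
    δ̂ (map (u ++_) T) a
      ≡⟨ concatMap-map (λ w → δ̂w w a) (u ++_) T ⟩
    concatMap (λ t → δ̂w (u ++ t) a) T
      ≈⟨ concatMap-∼-cong (λ t → δ̂w-++ u t a) T ⟩
    concatMap (λ t → δ̂w u a · [ t ] ++ i (ôw u) · δ̂w t a) T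
      ≈⟨ concatMap-++-pointwise (λ t → δ̂w u a · [ t ]) (λ t → i (ôw u) · δ̂w t a) T ⟩
    concatMap (λ t → δ̂w u a · [ t ]) T ++ concatMap (λ t → i (ôw u) · δ̂w t a) T
      ≈⟨ ++-cong (·-concatMapˡ [_] (δ̂w u a) T) (·-concatMapˡ (λ t → δ̂w t a) (i (ôw u)) T) ⟨
    δ̂w u a · concatMap [_] T ++ i (ôw u) · δ̂ T a
      ≡⟨ cong (λ S → δ̂w u a · S ++ i (ôw u) · δ̂ T a) (concat-map-[ T ]) ⟩
    δ̂w u a · T ++ i (ôw u) · δ̂ T a ∎
    where open ∼-Reasoning

  concatMap-i-ôw : (S : Language) → concatMap (λ s → i (ôw s)) S ∼[ set ] i (ô S)
  concatMap-i-ôw [] = Eq.refl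
  concatMap-i-ôw (s ∷ S) = Eq.trans (++-cong Eq.refl (concatMap-i-ôw S)) (Eq.sym (i-∨ (ôw s) (ô S)))

  δ̂-· : (S T : Language) (a : Fin nA) → δ̂ (S · T) a ∼[ set ] δ̂ S a · T ++ i (ô S) · δ̂ T a
  δ̂-· S T a = begin
    δ̂ (S · T) a
      ≡⟨ MonadProperties.associative S (λ s → map (s ++_) T) (λ w → δ̂w w a) ⟨
    concatMap (λ s → δ̂ (map (s ++_) T) a) S
      ≈⟨ concatMap-∼-cong (λ s → δ̂-map-prefix s T a) S ⟩
    concatMap (λ s → δ̂w s a · T ++ i (ôw s) · δ̂ T a) S
      ≈⟨ concatMap-++-pointwise (λ s → δ̂w s a · T) (λ s → i (ôw s) · δ̂ T a) S ⟩
    concatMap (λ s → δ̂w s a · T) S ++ concatMap (λ s → i (ôw s) · δ̂ T a) S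
      ≡⟨ cong₂ _++_ (·-concatMapʳ (λ s → δ̂w s a) S T) (·-concatMapʳ (λ s → i (ôw s)) S (δ̂ T a)) ⟨
    δ̂ S a · T ++ concatMap (λ s → i (ôw s)) S · δ̂ T a
      ≈⟨ ++-cong (Eq.refl {δ̂ S a · T}) (·-cong (concatMap-i-ôw S) (Eq.refl {δ̂ T a})) ⟩
    δ̂ S a · T ++ i (ô S) · δ̂ T a ∎
    where open ∼-Reasoning

  ô-letter : (y : Y nX nA) → ô [ [ y ] ] ≡ o′ y
  ô-letter y = trans (∨-identityʳ (o′ y ∧ true)) (∧-identityʳ (o′ y))

  δ̂-letter : (y : Y nX nA) (a : Fin nA) → δ̂ [ [ y ] ] a ≡ δ′ y a
  δ̂-letter y a = begin
    (δ′ y a · [ [] ] ++ i (o′ y) · []) ++ []  ≡⟨ ++-identityʳ (δ′ y a · [ [] ] ++ i (o′ y) · []) ⟩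
    δ′ y a · [ [] ] ++ i (o′ y) · []          ≡⟨ cong₂ _++_ (·-identityʳ (δ′ y a)) (·-zeroʳ (i (o′ y))) ⟩
    δ′ y a ++ []                              ≡⟨ ++-identityʳ (δ′ y a) ⟩
    δ′ y a                                    ∎
    where open ≡-Reasoning

  f-j : (b : Bool) → f (j b) ≡ i b
  f-j true = refl
  f-j false = refl

  ô-f : (σ : Term nX nA) → ô (f σ) ≡ ō σ
  ô-f 𝟘 = refl
  ô-f 𝟙 = refl
  ô-f (var x) = ô-letter (inj₁ x)
  ô-f (sym b) = refl
  ô-f (σ ⊕ υ) = trans (ô-++ (f σ) (f υ)) (cong₂ _∨_ (ô-f σ) (ô-f υ))
  ô-f (σ ⊗ υ) = trans (ô-· (f σ) (f υ)) (cong₂ _∧_ (ô-f σ) (ô-f υ))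

  δ̂-f : (σ : Term nX nA) (a : Fin nA) → δ̂ (f σ) a ∼[ set ] f (δ̄ σ a)
  δ̂-f 𝟘 a = Eq.refl
  δ̂-f 𝟙 a = Eq.refl
  δ̂-f (var x) a = Eq.reflexive (δ̂-letter (inj₁ x) a)
  δ̂-f (sym b) a with does (b ≟ a)
  ... | true = Eq.refl
  ... | false = Eq.refl
  δ̂-f (σ ⊕ υ) a = Eq.trans (Eq.reflexive (concatMap-++ (λ w → δ̂w w a) (f σ) (f υ)))
                           (++-cong (δ̂-f σ a) (δ̂-f υ a))
  δ̂-f (σ ⊗ υ) a = Eq.trans (δ̂-· (f σ) (f υ) a)
    (++-cong (·-cong (δ̂-f σ a) Eq.refl)
             (·-cong (Eq.reflexive (trans (cong i (ô-f σ)) (≡.sym (f-j (ō σ))))) (δ̂-f υ a)))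

proposition4p2 : {nX nA : ℕ} (o : Fin nX → Bool) (δ : Fin nX → Fin nA → Term nX nA) →
    let open System o δ in
      (σ : Term nX nA) (a : Fin nA) → (ô (f σ) ≡ ō σ) × (δ̂ (f σ) a ≋ f (δ̄ σ a))
proposition4p2 o δ σ a = ô-f σ , ∼⇒≋ (δ̂-f σ a)
  where open Homomorphism o δ
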